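{- Let $N=\sum_{i=0}^k \nu_i 10^i$, where $\nu_0,\dots,\nu_k$ are nonnegative integers (not necessarily in the range $0$ to $9$), and let $b$ be an integer with $b\ge 10$. Then $$N_{b} \;\ge\; \sum_{i=0}^k \nu_i b^i ,$$ where $N_b$ denotes $N$ read in base $b$ (see context).
   Context: For a nonnegative integer $N$ with ordinary decimal expansion $N=\sum_{i=0}^{m} d_i 10^i$, $d_i\in\{0,1,\dots,9\}$, and a real number $b>1$, the base-change $N_b$ (also written $N\_b$) is defined as $N_b:=\sum_{i=0}^{m} d_i b^i$, i.e. the result of interpreting the decimal digit string of $N$ in base $b$. -}

module Defs where

open import Data.Nat using (ℕ; zero; suc; _+_; _*_; _^_)
open import Data.Nat.DivMod using (_/_; _%_)
open import Data.List using (List; []; _∷_)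

-- With fuel ≥ n the expansion is complete (n / 10 < n for n > 0);
-- digits of 0 is the empty list (leading zeros do not affect N_b).
digitsAux : ℕ → ℕ → List ℕ
digitsAux zero    n       = []
digitsAux (suc f) zero    = []
digitsAux (suc f) (suc n) = (suc n % 10) ∷ digitsAux f (suc n / 10)

decDigits : ℕ → List ℕ
decDigits n = digitsAux n n

evalBase : ℕ → List ℕ → ℕ
evalBase b []       = 0
evalBase b (d ∷ ds) = d + b * evalBase b ds

baseChange : ℕ → ℕ → ℕ
baseChange N b = evalBase b (decDigits N)

sumTo : ℕ → (ℕ → ℕ) → ℕ
sumTo zero    f = f 0
sumTo (suc k) f = sumTo k f + f (suc k)

{-# OPTIONS --safe #-}
module Submission where

-- Write M = a + 10 m, N = a' + 10 n with digits a, a', and a + a' + c = d + 10 e with d a digit.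
-- Then M + N + c = d + 10 (m + n + e), and reading in base b,
--   M_b + N_b + c = d + 10 e + b (m_b + n_b) ≤ d + b (m_b + n_b + e) ≤ (M + N + c)_b,
-- the first step because a carry worth 10 at one position is worth b ≥ 10 one position up,
-- the second by induction. This superadditivity with an arbitrary carry c gives c ≤ c_b
-- (take M = N = 0) and, as (ν 10^i)_b = b^i ν_b, the theorem.

open import Defs
open import Data.Nat using (ℕ; zero; suc; _+_; _*_; _^_; _≤_; _≥_; _<_; z≤n; s≤s; z<s; s<s; NonZero; ≢-nonZero)
open import Data.Nat.Properties
open import Data.Nat.DivMod
open import Data.Nat.Divisibility using (divides-refl)
open import Data.Nat.Induction using (<-wellFounded)
open import Data.Nat.Tactic.RingSolver using (solve-∀)
open import Data.List using (_∷_)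
open import Induction.WellFounded using (Acc; acc)
open import Relation.Binary.PropositionalEquality using (_≡_; refl; sym; trans; cong; cong₂; module ≡-Reasoning)
open import Relation.Nullary using (yes; no)

[r+q*n]%n≡r : ∀ {r} q n .{{_ : NonZero n}} → r < n → (r + q * n) % n ≡ r
[r+q*n]%n≡r {r} q n r<n = trans ([m+kn]%n≡m%n r q n) (m<n⇒m%n≡m r<n)

[r+q*n]/n≡q : ∀ {r} q n .{{_ : NonZero n}} → r < n → (r + q * n) / n ≡ q
[r+q*n]/n≡q {r} q n r<n =
  trans (+-distrib-/-∣ʳ r (divides-refl q)) (cong₂ _+_ (m<n⇒m/n≡0 r<n) (m*n/n≡m q n))

1+n/10≤n : ∀ n → suc n / 10 ≤ n
1+n/10≤n n = ≤-pred (m/n<m (suc n) 10 (s<s z<s))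

digitsAux-fuel : ∀ f g n → n ≤ f → n ≤ g → digitsAux f n ≡ digitsAux g n
digitsAux-fuel zero    zero    zero    _         _         = refl
digitsAux-fuel zero    (suc g) zero    _         _         = refl
digitsAux-fuel (suc f) zero    zero    _         _         = refl
digitsAux-fuel (suc f) (suc g) zero    _         _         = refl
digitsAux-fuel (suc f) (suc g) (suc n) (s≤s n≤f) (s≤s n≤g) =
  cong (suc n % 10 ∷_) (digitsAux-fuel f g (suc n / 10)
    (≤-trans (1+n/10≤n n) n≤f) (≤-trans (1+n/10≤n n) n≤g))

module _ {b : ℕ} where

  ⟦_⟧ : ℕ → ℕ
  ⟦ N ⟧ = baseChange N b

  ⟦n⟧≡n%10+b*⟦n/10⟧ : ∀ n → ⟦ n ⟧ ≡ n % 10 + b * ⟦ n / 10 ⟧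
  ⟦n⟧≡n%10+b*⟦n/10⟧ zero    = sym (*-zeroʳ b)
  ⟦n⟧≡n%10+b*⟦n/10⟧ (suc n) = cong (λ ds → suc n % 10 + b * evalBase b ds)
    (digitsAux-fuel n (suc n / 10) (suc n / 10) (1+n/10≤n n) ≤-refl)

  ⟦r+q*10⟧≡r+b*⟦q⟧ : ∀ {r} q → r < 10 → ⟦ r + q * 10 ⟧ ≡ r + b * ⟦ q ⟧
  ⟦r+q*10⟧≡r+b*⟦q⟧ {r} q r<10 = trans (⟦n⟧≡n%10+b*⟦n/10⟧ (r + q * 10))
    (cong₂ (λ d q′ → d + b * ⟦ q′ ⟧) ([r+q*n]%n≡r q 10 r<10) ([r+q*n]/n≡q q 10 r<10))

  ⟦n*10^i⟧≡b^i*⟦n⟧ : ∀ n i → ⟦ n * 10 ^ i ⟧ ≡ b ^ i * ⟦ n ⟧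
  ⟦n*10^i⟧≡b^i*⟦n⟧ n zero    = trans (cong ⟦_⟧ (*-identityʳ n)) (sym (*-identityˡ ⟦ n ⟧))
  ⟦n*10^i⟧≡b^i*⟦n⟧ n (suc i) = begin
    ⟦ n * (10 * 10 ^ i) ⟧   ≡⟨ cong ⟦_⟧ (trans (cong (n *_) (*-comm 10 (10 ^ i))) (sym (*-assoc n (10 ^ i) 10))) ⟩
    ⟦ 0 + n * 10 ^ i * 10 ⟧ ≡⟨ ⟦r+q*10⟧≡r+b*⟦q⟧ (n * 10 ^ i) z<s ⟩
    b * ⟦ n * 10 ^ i ⟧      ≡⟨ cong (b *_) (⟦n*10^i⟧≡b^i*⟦n⟧ n i) ⟩
    b * (b ^ i * ⟦ n ⟧)     ≡⟨ *-assoc b (b ^ i) ⟦ n ⟧ ⟨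
    b * b ^ i * ⟦ n ⟧       ∎
    where open ≡-Reasoning

  module _ (b≥10 : b ≥ 10) where

    column-step : ∀ {a a′ c d e} m n → a < 10 → a′ < 10 → d < 10 →
                  a + a′ + c ≡ d + e * 10 →
                  ⟦ m ⟧ + ⟦ n ⟧ + e ≤ ⟦ m + n + e ⟧ →
                  ⟦ a + m * 10 ⟧ + ⟦ a′ + n * 10 ⟧ + c ≤ ⟦ d + (m + n + e) * 10 ⟧
    column-step {a} {a′} {c} {d} {e} m n a<10 a′<10 d<10 column rest = begin
      ⟦ a + m * 10 ⟧ + ⟦ a′ + n * 10 ⟧ + c
        ≡⟨ cong₂ (λ x y → x + y + c) (⟦r+q*10⟧≡r+b*⟦q⟧ m a<10) (⟦r+q*10⟧≡r+b*⟦q⟧ n a′<10) ⟩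
      (a + b * ⟦ m ⟧) + (a′ + b * ⟦ n ⟧) + c
        ≡⟨ collect-digits a a′ c b ⟦ m ⟧ ⟦ n ⟧ ⟩
      (a + a′ + c) + b * (⟦ m ⟧ + ⟦ n ⟧)
        ≡⟨ cong (_+ b * (⟦ m ⟧ + ⟦ n ⟧)) column ⟩
      d + e * 10 + b * (⟦ m ⟧ + ⟦ n ⟧)
        ≤⟨ +-monoˡ-≤ _ (+-monoʳ-≤ d (*-monoʳ-≤ e b≥10)) ⟩
      d + e * b + b * (⟦ m ⟧ + ⟦ n ⟧)
        ≡⟨ absorb-carry d e b ⟦ m ⟧ ⟦ n ⟧ ⟩
      d + b * (⟦ m ⟧ + ⟦ n ⟧ + e)
        ≤⟨ +-monoʳ-≤ d (*-monoʳ-≤ b rest) ⟩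
      d + b * ⟦ m + n + e ⟧
        ≡⟨ ⟦r+q*10⟧≡r+b*⟦q⟧ (m + n + e) d<10 ⟨
      ⟦ d + (m + n + e) * 10 ⟧ ∎
      where
      open ≤-Reasoning
      collect-digits : ∀ a a′ c b x y → (a + b * x) + (a′ + b * y) + c ≡ (a + a′ + c) + b * (x + y)
      collect-digits = solve-∀
      absorb-carry : ∀ d e b x y → d + e * b + b * (x + y) ≡ d + b * (x + y + e)
      absorb-carry = solve-∀

    ⟦m⟧+⟦n⟧+c≤⟦m+n+c⟧ : ∀ M N c → ⟦ M ⟧ + ⟦ N ⟧ + c ≤ ⟦ M + N + c ⟧
    ⟦m⟧+⟦n⟧+c≤⟦m+n+c⟧ M N c = go M N c (<-wellFounded (M + N + c))
      where
      go : ∀ M N c → Acc _<_ (M + N + c) → ⟦ M ⟧ + ⟦ N ⟧ + c ≤ ⟦ M + N + c ⟧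
      go M N c (acc smaller) with M + N + c ≟ 0
      ... | yes M+N+c≡0
        rewrite m+n≡0⇒m≡0 M (m+n≡0⇒m≡0 (M + N) M+N+c≡0)
              | m+n≡0⇒n≡0 M (m+n≡0⇒m≡0 (M + N) M+N+c≡0)
              | m+n≡0⇒n≡0 (M + N) M+N+c≡0 = z≤n
      ... | no M+N+c≢0 = begin
        ⟦ M ⟧ + ⟦ N ⟧ + c
          ≡⟨ cong₂ (λ x y → ⟦ x ⟧ + ⟦ y ⟧ + c) (m≡m%n+[m/n]*n M 10) (m≡m%n+[m/n]*n N 10) ⟩
        ⟦ M % 10 + m * 10 ⟧ + ⟦ N % 10 + n * 10 ⟧ + c
          ≤⟨ column-step m n (m%n<n M 10) (m%n<n N 10) (m%n<n t 10) (m≡m%n+[m/n]*n t 10)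
               (go m n e (smaller quotient<sum)) ⟩
        ⟦ t % 10 + (m + n + e) * 10 ⟧
          ≡⟨ cong ⟦_⟧ sum≡digits ⟨
        ⟦ M + N + c ⟧ ∎
        where
        open ≤-Reasoning
        m = M / 10
        n = N / 10
        t = M % 10 + N % 10 + c
        e = t / 10

        sum≡digits : M + N + c ≡ t % 10 + (m + n + e) * 10
        sum≡digits = ≡.begin
          M + N + c
            ≡.≡⟨ cong₂ (λ x y → x + y + c) (m≡m%n+[m/n]*n M 10) (m≡m%n+[m/n]*n N 10) ⟩
          (M % 10 + m * 10) + (N % 10 + n * 10) + c
            ≡.≡⟨ collect-units (M % 10) m (N % 10) n c ⟩
          t + (m + n) * 10
            ≡.≡⟨ cong (_+ (m + n) * 10) (m≡m%n+[m/n]*n t 10) ⟩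
          (t % 10 + e * 10) + (m + n) * 10
            ≡.≡⟨ collect-tens (t % 10) e m n ⟩
          t % 10 + (m + n + e) * 10 ≡.∎
          where
          module ≡ = ≡-Reasoning
          collect-units : ∀ a m a′ n c → (a + m * 10) + (a′ + n * 10) + c ≡ (a + a′ + c) + (m + n) * 10
          collect-units = solve-∀
          collect-tens : ∀ d e m n → (d + e * 10) + (m + n) * 10 ≡ d + (m + n + e) * 10
          collect-tens = solve-∀

        quotient<sum : m + n + e < M + N + c
        quotient<sum = begin-strict
          m + n + e                              ≡⟨ [r+q*n]/n≡q (m + n + e) 10 (m%n<n t 10) ⟨
          (t % 10 + (m + n + e) * 10) / 10       ≡⟨ cong (_/ 10) sum≡digits ⟨
          (M + N + c) / 10                       <⟨ m/n<m (M + N + c) 10 {{≢-nonZero M+N+c≢0}} (s<s z<s) ⟩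
          M + N + c                              ∎

    ⟦m⟧+⟦n⟧≤⟦m+n⟧ : ∀ M N → ⟦ M ⟧ + ⟦ N ⟧ ≤ ⟦ M + N ⟧
    ⟦m⟧+⟦n⟧≤⟦m+n⟧ M N = begin
      ⟦ M ⟧ + ⟦ N ⟧     ≡⟨ +-identityʳ _ ⟨
      ⟦ M ⟧ + ⟦ N ⟧ + 0 ≤⟨ ⟦m⟧+⟦n⟧+c≤⟦m+n+c⟧ M N 0 ⟩
      ⟦ M + N + 0 ⟧     ≡⟨ cong ⟦_⟧ (+-identityʳ (M + N)) ⟩
      ⟦ M + N ⟧         ∎
      where open ≤-Reasoning

    -- ⟦ 0 ⟧ reduces to 0.
    n≤⟦n⟧ : ∀ n → n ≤ ⟦ n ⟧
    n≤⟦n⟧ n = ⟦m⟧+⟦n⟧+c≤⟦m+n+c⟧ 0 0 n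

    n*b^i≤⟦n*10^i⟧ : ∀ n i → n * b ^ i ≤ ⟦ n * 10 ^ i ⟧
    n*b^i≤⟦n*10^i⟧ n i = begin
      n * b ^ i      ≡⟨ *-comm n (b ^ i) ⟩
      b ^ i * n      ≤⟨ *-monoʳ-≤ (b ^ i) (n≤⟦n⟧ n) ⟩
      b ^ i * ⟦ n ⟧  ≡⟨ ⟦n*10^i⟧≡b^i*⟦n⟧ n i ⟨
      ⟦ n * 10 ^ i ⟧ ∎
      where open ≤-Reasoning

    sumTo-≤⟦⟧ : ∀ k (f g : ℕ → ℕ) → (∀ i → f i ≤ ⟦ g i ⟧) → sumTo k f ≤ ⟦ sumTo k g ⟧
    sumTo-≤⟦⟧ zero    f g f≤⟦g⟧ = f≤⟦g⟧ 0
    sumTo-≤⟦⟧ (suc k) f g f≤⟦g⟧ = begin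
      sumTo k f + f (suc k)       ≤⟨ +-mono-≤ (sumTo-≤⟦⟧ k f g f≤⟦g⟧) (f≤⟦g⟧ (suc k)) ⟩
      ⟦ sumTo k g ⟧ + ⟦ g (suc k) ⟧ ≤⟨ ⟦m⟧+⟦n⟧≤⟦m+n⟧ (sumTo k g) (g (suc k)) ⟩
      ⟦ sumTo k g + g (suc k) ⟧     ∎
      where open ≤-Reasoning

lemma1 : (k : ℕ) (ν : ℕ → ℕ) (N b : ℕ) →
         N ≡ sumTo k (λ i → ν i * 10 ^ i) →
         b ≥ 10 →
         baseChange N b ≥ sumTo k (λ i → ν i * b ^ i)
lemma1 k ν N b refl b≥10 = sumTo-≤⟦⟧ b≥10 k _ _ (λ i → n*b^i≤⟦n*10^i⟧ b≥10 (ν i) i)
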